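{- Let $\mathbf{C}$ be a category in which the class $\mathcal{M}=\mathrm{mono}(\mathbf{C})$ of all monomorphisms is a stable system of monics, which has pullbacks along monomorphisms, and which has a $\mathrm{mono}(\mathbf{C})$-partial map classifier. Let $f:A\to B$ and $m:B\to C$ be monomorphisms, and let $(n:A\to F,g:F\to C)$ be a final pullback complement of $(f,m)$. Then both $n$ and $g$ are monomorphisms.
   Context: A stable system of monics is a class $\mathcal{M}$ of monomorphisms containing all isomorphisms, closed under composition, and stable under pullback. For such $\mathcal{M}$, an $\mathcal{M}$-partial map classifier $(T,\eta)$ is a functor $T:\mathbf{C}\to\mathbf{C}$ with a natural transformation $\eta:\mathrm{Id}_{\mathbf{C}}\Rightarrow T$ such that each $\eta_X$ is in $\mathcal{M}$, and for each span $A\xleftarrow{m}X\xrightarrow{f}B$ with $m\in\mathcal{M}$ there is a unique $\varphi(m,f):A\to T(B)$ such that $(m,f)$ is a pullback of $(\varphi(m,f),\eta_B)$. Given composable $f:A\to B$, $m:B\to C$, a pair $(n:A\to F,g:F\to C)$ is a final pullback complement of $(f,m)$ if $g\circ n=m\circ f$, this square is a pullback, and for every pullback square $d\circ y=m\circ z$ ($z:X\to B$, $y:X\to Y$, $d:Y\to C$) and every $x:X\to A$ with $f\circ x=z$ there is a unique $x':Y\to F$ with $g\circ x'=d$ and $x'\circ y=n\circ x$. -}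

module Defs where

open import Level using (Level; _⊔_; suc)
open import Relation.Binary using (IsEquivalence)
open import Data.Product using (Σ; Σ-syntax; _×_; _,_)

record Category (o ℓ e : Level) : Set (suc (o ⊔ ℓ ⊔ e)) where
  infix  4 _≈_
  infixr 9 _∘_
  field
    Obj : Set o
    _⇒_ : Obj → Obj → Set ℓ
    _≈_ : ∀ {A B} → A ⇒ B → A ⇒ B → Set e
    id  : ∀ {A} → A ⇒ A
    _∘_ : ∀ {A B C} → B ⇒ C → A ⇒ B → A ⇒ C
    assoc     : ∀ {A B C D} {f : A ⇒ B} {g : B ⇒ C} {h : C ⇒ D} →
                (h ∘ g) ∘ f ≈ h ∘ (g ∘ f)
    identityˡ : ∀ {A B} {f : A ⇒ B} → id ∘ f ≈ f
    identityʳ : ∀ {A B} {f : A ⇒ B} → f ∘ id ≈ f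
    equiv     : ∀ {A B} → IsEquivalence (_≈_ {A} {B})
    ∘-resp-≈  : ∀ {A B C} {f h : B ⇒ C} {g i : A ⇒ B} →
                f ≈ h → g ≈ i → f ∘ g ≈ h ∘ i

module _ {o ℓ e : Level} (𝒞 : Category o ℓ e) where
  open Category 𝒞

  Mono : ∀ {A B} → A ⇒ B → Set (o ⊔ ℓ ⊔ e)
  Mono {A} f = ∀ {X} (g h : X ⇒ A) → f ∘ g ≈ f ∘ h → g ≈ h

  IsIso : ∀ {A B} → A ⇒ B → Set (ℓ ⊔ e)
  IsIso {A} {B} f = Σ[ g ∈ B ⇒ A ] ((g ∘ f ≈ id) × (f ∘ g ≈ id))

  ∃!≈ : ∀ {p} {X Y} → (X ⇒ Y → Set p) → Set (ℓ ⊔ e ⊔ p)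
  ∃!≈ {X = X} {Y} P = Σ[ u ∈ X ⇒ Y ] (P u × (∀ (v : X ⇒ Y) → P v → v ≈ u))

  record IsPullback {P A B C : Obj} (p₁ : P ⇒ A) (p₂ : P ⇒ B)
                    (f : A ⇒ C) (g : B ⇒ C) : Set (o ⊔ ℓ ⊔ e) where
    field
      commute   : f ∘ p₁ ≈ g ∘ p₂
      universal : ∀ {X} (h₁ : X ⇒ A) (h₂ : X ⇒ B) → f ∘ h₁ ≈ g ∘ h₂ →
                  ∃!≈ (λ (u : X ⇒ P) → (p₁ ∘ u ≈ h₁) × (p₂ ∘ u ≈ h₂))

  MorClass : (r : Level) → Set (o ⊔ ℓ ⊔ suc r)
  MorClass r = ∀ {A B} → A ⇒ B → Set r

  record IsStableSystem {r : Level} (ℳ : MorClass r) : Set (o ⊔ ℓ ⊔ e ⊔ r) where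
    field
      monic    : ∀ {A B} {m : A ⇒ B} → ℳ m → Mono m
      isos     : ∀ {A B} {f : A ⇒ B} → IsIso f → ℳ f
      ∘-closed : ∀ {A B C} {m : B ⇒ C} {n : A ⇒ B} → ℳ m → ℳ n → ℳ (m ∘ n)
      stable   : ∀ {P A B C} {p₁ : P ⇒ A} {p₂ : P ⇒ B} {f : A ⇒ C} {m : B ⇒ C} →
                 ℳ m → IsPullback p₁ p₂ f m → ℳ p₁

  HasPullbacksAlongMonos : Set (o ⊔ ℓ ⊔ e)
  HasPullbacksAlongMonos =
    ∀ {A B C} (f : A ⇒ C) (m : B ⇒ C) → Mono m →
    Σ[ P ∈ Obj ] Σ[ p₁ ∈ P ⇒ A ] Σ[ p₂ ∈ P ⇒ B ] IsPullback p₁ p₂ f m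

  record PartialMapClassifier {r : Level} (ℳ : MorClass r) : Set (o ⊔ ℓ ⊔ e ⊔ r) where
    field
      T₀   : Obj → Obj
      T₁   : ∀ {A B} → A ⇒ B → T₀ A ⇒ T₀ B
      T-id      : ∀ {A} → T₁ (id {A}) ≈ id
      T-∘       : ∀ {A B C} {f : A ⇒ B} {g : B ⇒ C} → T₁ (g ∘ f) ≈ T₁ g ∘ T₁ f
      T-resp-≈  : ∀ {A B} {f g : A ⇒ B} → f ≈ g → T₁ f ≈ T₁ g
      η         : ∀ X → X ⇒ T₀ X
      η-natural : ∀ {A B} (f : A ⇒ B) → η B ∘ f ≈ T₁ f ∘ η A
      η-in-ℳ    : ∀ X → ℳ (η X)
      classify  : ∀ {A X B} (m : X ⇒ A) (f : X ⇒ B) → ℳ m →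
                  ∃!≈ (λ (φ : A ⇒ T₀ B) → IsPullback m f φ (η B))

  record IsFPC {A B C F : Obj} (f : A ⇒ B) (m : B ⇒ C)
               (n : A ⇒ F) (g : F ⇒ C) : Set (o ⊔ ℓ ⊔ e) where
    field
      pullback : IsPullback n f g m
      final    : ∀ {X Y} (z : X ⇒ B) (y : X ⇒ Y) (d : Y ⇒ C) →
                 IsPullback y z d m →
                 (x : X ⇒ A) → f ∘ x ≈ z →
                 ∃!≈ (λ (x' : Y ⇒ F) → (g ∘ x' ≈ d) × (x' ∘ y ≈ n ∘ x))

{-# OPTIONS --safe #-}
-- n is a pullback of the monic m, hence monic.  For g, suppose g ∘ u ≈ g ∘ v and
-- pull m back along d = g ∘ u to (y , z).  Both u ∘ y and v ∘ y complete the
-- cospan (g , m) with z, so they factor through the pullback (n , f), and since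
-- f is monic both factorisations are the same x.  Then u and v solve the same
-- finality problem for the square (y , z , d) and x, so u ≈ v by uniqueness.
module Submission where

open import Defs
open import Level using (Level)
open import Data.Product using (_×_; _,_)
open import Relation.Binary using (IsEquivalence)

module _ {o ℓ e : Level} (𝒞 : Category o ℓ e) where
  open Category 𝒞
  private
    module ≈ {X Y : Obj} = IsEquivalence (equiv {X} {Y})

  pullback-factor-unique : ∀ {P A B C X} {p₁ : P ⇒ A} {p₂ : P ⇒ B}
    {f : A ⇒ C} {m : B ⇒ C} → IsPullback 𝒞 p₁ p₂ f m → Mono 𝒞 p₂ →
    {w : X ⇒ A} {z : X ⇒ B} {x : X ⇒ P} →
    f ∘ w ≈ m ∘ z → p₂ ∘ x ≈ z → w ≈ p₁ ∘ x
  pullback-factor-unique pb p₂-mono {w} {z} {x} fw≈mz p₂x≈z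
    with IsPullback.universal pb w z fw≈mz
  ... | u , (p₁u≈w , p₂u≈z) , _ =
    ≈.trans (≈.sym p₁u≈w) (∘-resp-≈ ≈.refl u≈x)
    where
    u≈x : u ≈ x
    u≈x = p₂-mono u x (≈.trans p₂u≈z (≈.sym p₂x≈z))

  square-precompose : ∀ {X Y P B C} {g : P ⇒ C} {w : Y ⇒ P} {d : Y ⇒ C}
    {y : X ⇒ Y} {m : B ⇒ C} {z : X ⇒ B} →
    g ∘ w ≈ d → d ∘ y ≈ m ∘ z → g ∘ (w ∘ y) ≈ m ∘ z
  square-precompose gw≈d dy≈mz =
    ≈.trans (≈.sym assoc) (≈.trans (∘-resp-≈ gw≈d ≈.refl) dy≈mz)

  fpc-cancels-along-pullback : ∀ {A B C F P}
    {f : A ⇒ B} {m : B ⇒ C} {n : A ⇒ F} {g : F ⇒ C} →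
    Mono 𝒞 f → IsFPC 𝒞 f m n g →
    {u v : P ⇒ F} {Q : Obj} {y : Q ⇒ P} {z : Q ⇒ B} →
    IsPullback 𝒞 y z (g ∘ u) m → g ∘ u ≈ g ∘ v → u ≈ v
  fpc-cancels-along-pullback {F = F} {P} {g = g} f-mono fpc {u} {v} {y = y} {z} pb gu≈gv
    with IsPullback.universal (IsFPC.pullback fpc) (u ∘ y) z
           (square-precompose ≈.refl (IsPullback.commute pb))
  ... | x , (_ , fx≈z) , _
    with IsFPC.final fpc z y (g ∘ u) pb x fx≈z
  ... | x' , _ , unique = ≈.trans (solves u ≈.refl) (≈.sym (solves v (≈.sym gu≈gv)))
    where
    solves : (w : P ⇒ F) → g ∘ w ≈ g ∘ u → w ≈ x'
    solves w gw≈gu = unique w (gw≈gu ,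
      pullback-factor-unique (IsFPC.pullback fpc) f-mono
        (square-precompose gw≈gu (IsPullback.commute pb)) fx≈z)

  fpc-complement-mono : ∀ {A B C F}
    {f : A ⇒ B} {m : B ⇒ C} {n : A ⇒ F} {g : F ⇒ C} →
    Mono 𝒞 f → Mono 𝒞 m → HasPullbacksAlongMonos 𝒞 →
    IsFPC 𝒞 f m n g → Mono 𝒞 g
  fpc-complement-mono {g = g} f-mono m-mono pullbacks fpc u v gu≈gv
    with pullbacks (g ∘ u) _ m-mono
  ... | _ , _ , _ , pb = fpc-cancels-along-pullback f-mono fpc pb gu≈gv

lemma9 : ∀ {o ℓ e : Level} (𝒞 : Category o ℓ e) →
    IsStableSystem 𝒞 (Mono 𝒞) →
    HasPullbacksAlongMonos 𝒞 →
    PartialMapClassifier 𝒞 (Mono 𝒞) →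
    ∀ {A B C F : Category.Obj 𝒞}
    (f : Category._⇒_ 𝒞 A B) (m : Category._⇒_ 𝒞 B C)
    (n : Category._⇒_ 𝒞 A F) (g : Category._⇒_ 𝒞 F C) →
    Mono 𝒞 f → Mono 𝒞 m →
    IsFPC 𝒞 f m n g →
    Mono 𝒞 n × Mono 𝒞 g
lemma9 𝒞 stable-monos pullbacks _ f m n g f-mono m-mono fpc =
  IsStableSystem.stable stable-monos m-mono (IsFPC.pullback fpc) ,
  fpc-complement-mono 𝒞 f-mono m-mono pullbacks fpc
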